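{- For integers $n>h\geq 0$, \[ L_{n+1}^{(h)}=F_n^{(h)}+(h+1)F_{n-h}^{(h)}. \]
   Context: The $h$-Fibonacci sequence $(F_n^{(h)})_{n\geq 1}$ is defined by $F_n^{(h)}=1$ for $1\leq n\leq h+1$ and $F_n^{(h)}=F_{n-1}^{(h)}+F_{n-h-1}^{(h)}$ for $n>h+1$. The $h$-Lucas sequence $(L_n^{(h)})_{n\geq 1}$ is defined by $L_1^{(h)}=h+1$, $L_n^{(h)}=1$ for $2\leq n\leq h+1$, and $L_n^{(h)}=L_{n-1}^{(h)}+L_{n-h-1}^{(h)}$ for $n>h+1$. -}

module Defs where

open import Data.Nat using (ℕ; zero; suc; _+_; _∸_; _≤?_)
open import Relation.Nullary using (yes; no)

-- Generic (h+1)-step recurrence on 1-indexed sequences: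
--   s n = init n                 for 1 ≤ n ≤ h+1
--   s n = s (n-1) + s (n-h-1)    for n > h+1
-- Defined with a fuel argument (fuel ≥ n suffices); index 0 is unused (value 0).
hrec : (h : ℕ) → (ℕ → ℕ) → (fuel : ℕ) → ℕ → ℕ
hrec h init zero n = 0
hrec h init (suc fuel) zero = 0
hrec h init (suc fuel) (suc m) with m ≤? h
... | yes _ = init (suc m)
... | no _ = hrec h init fuel m + hrec h init fuel (m ∸ h)

fibInit : ℕ → ℕ
fibInit _ = 1

F : ℕ → ℕ → ℕ
F h n = hrec h fibInit n n

lucInit : ℕ → ℕ → ℕ
lucInit h 1 = suc h
lucInit h _ = 1

L : ℕ → ℕ → ℕ
L h n = hrec h (lucInit h) n n

module Submission where

-- Write F, L for the h-Fibonacci and h-Lucas sequences and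
-- put F₀ = 0 (the value the definition assigns to the unused index 0).
-- With this convention F obeys its recurrence F_{n+1} = F_n + F_{n-h}
-- (truncated subtraction) for every n ≥ 1, not only for n > h, because
-- for 1 ≤ n ≤ h it reads 1 = 1 + F₀.  The theorem is therefore equivalent
-- to the companion identity
--     L_{n+1} = F_{n+1} + h·F_{n-h}        (n ≥ 1),
-- since F_{n+1} + h·F_{n-h} = F_n + (h+1)·F_{n-h}.  The companion identity
-- is proved by strong induction on n: it is immediate for n ≤ h (both
-- sides are 1), a direct computation for n = h+1, and for n > h+1 both
-- sides satisfy the (h+1)-step recurrence, so it follows from the
-- instances at n-1 and n-h-1.

open import Defs
open import Data.Nat using (ℕ; zero; suc; _+_; _*_; _∸_; _<_; _≤_; z≤n; s≤s; _≤?_)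
open import Data.Nat.Properties
open import Data.Nat.Induction using (<-rec)
open import Algebra.Properties.CommutativeSemigroup +-commutativeSemigroup using (interchange)
open import Relation.Binary.Definitions using (tri<; tri≈; tri>)
open import Relation.Binary.PropositionalEquality
open import Relation.Nullary using (yes; no)
open import Data.Empty using (⊥-elim)
open import Data.Sum using (inj₁; inj₂)
open ≡-Reasoning

hseq : ℕ → (ℕ → ℕ) → ℕ → ℕ
hseq h init n = hrec h init n n

hrec-fuel : ∀ h init f g n → n ≤ f → n ≤ g → hrec h init f n ≡ hrec h init g n
hrec-fuel h init zero zero zero _ _ = refl
hrec-fuel h init zero (suc g) zero _ _ = refl
hrec-fuel h init (suc f) zero zero _ _ = refl
hrec-fuel h init (suc f) (suc g) zero _ _ = refl
hrec-fuel h init (suc f) (suc g) (suc m) (s≤s m≤f) (s≤s m≤g) with m ≤? h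
... | yes _ = refl
... | no _ = cong₂ _+_ (hrec-fuel h init f g m m≤f m≤g)
                       (hrec-fuel h init f g (m ∸ h) (≤-trans (m∸n≤m m h) m≤f)
                                                     (≤-trans (m∸n≤m m h) m≤g))

hseq-init : ∀ h init t → t ≤ h → hseq h init (suc t) ≡ init (suc t)
hseq-init h init t t≤h with t ≤? h
... | yes _ = refl
... | no t≰h = ⊥-elim (t≰h t≤h)

hseq-rec : ∀ h init n → h < n → hseq h init (suc n) ≡ hseq h init n + hseq h init (n ∸ h)
hseq-rec h init n h<n with n ≤? h
... | yes n≤h = ⊥-elim (<⇒≱ h<n n≤h)
... | no _ = cong (hseq h init n +_)
                  (hrec-fuel h init n (n ∸ h) (n ∸ h) (m∸n≤m n h) ≤-refl)

F-rec : ∀ h n → 0 < n → F h (suc n) ≡ F h n + F h (n ∸ h)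
F-rec h n 0<n with ≤-<-connex n h
... | inj₂ h<n = hseq-rec h fibInit n h<n
F-rec h (suc t) _ | inj₁ n≤h = begin
  F h (suc (suc t))            ≡⟨ hseq-init h fibInit (suc t) n≤h ⟩
  1                            ≡⟨ cong₂ _+_ (sym (hseq-init h fibInit t (<⇒≤ n≤h)))
                                            (cong (F h) (sym (m≤n⇒m∸n≡0 n≤h))) ⟩
  F h (suc t) + F h (suc t ∸ h) ∎

L-window : ∀ h t → t < h → L h (suc (suc t)) ≡ 1
L-window h t t<h = hseq-init h (lucInit h) (suc t) t<h

-- L_{h+1} = 1 (for h = 0 this is L₁ = h+1 = 1).
L-last-initial : ∀ h → L h (suc h) ≡ 1
L-last-initial zero = refl
L-last-initial (suc h) = L-window (suc h) h ≤-refl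

LucasIdentity : ℕ → ℕ → Set
LucasIdentity h n = 0 < n → L h (suc n) ≡ F h (suc n) + h * F h (n ∸ h)

lucas-as-fib : ∀ h n → LucasIdentity h n
lucas-as-fib h = <-rec (LucasIdentity h) step
  where
  -- n ≤ h: L_{n+1} = 1 = F_{n+1}, and F_{n-h} = F₀ = 0.
  window : ∀ t → t < h → LucasIdentity h (suc t)
  window t t<h _ = begin
    L h (suc (suc t))                 ≡⟨ L-window h t t<h ⟩
    1                                 ≡⟨ cong (1 +_) (sym (*-zeroʳ h)) ⟩
    1 + h * 0                         ≡⟨ cong₂ (λ x y → x + h * y)
                                          (sym (hseq-init h fibInit (suc t) t<h))
                                          (cong (F h) (sym (m≤n⇒m∸n≡0 t<h))) ⟩
    F h (suc (suc t)) + h * F h (suc t ∸ h) ∎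

  -- n = h+1: L_{h+2} = L_{h+1} + L₁ = h+2 and F_{h+2} + h·F₁ = 2 + h.
  first : LucasIdentity h (suc h)
  first _ = begin
    L h (suc (suc h))                 ≡⟨ hseq-rec h (lucInit h) (suc h) ≤-refl ⟩
    L h (suc h) + L h (suc h ∸ h)     ≡⟨ cong₂ (λ x y → x + L h y) (L-last-initial h) one ⟩
    1 + suc h                         ≡⟨ cong (2 +_) (sym (*-identityʳ h)) ⟩
    2 + h * 1                         ≡⟨ cong₂ (λ x y → x + h * F h y)
                                          (sym F-h+2) (sym one) ⟩
    F h (suc (suc h)) + h * F h (suc h ∸ h) ∎
    where
    one : suc h ∸ h ≡ 1
    one = m+n∸n≡m 1 h
    F-h+2 : F h (suc (suc h)) ≡ 2
    F-h+2 = begin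
      F h (suc (suc h))               ≡⟨ F-rec h (suc h) (s≤s z≤n) ⟩
      F h (suc h) + F h (suc h ∸ h)   ≡⟨ cong₂ (λ x y → x + F h y)
                                          (hseq-init h fibInit h ≤-refl) one ⟩
      2 ∎

  -- n = m+1 > h+1: both sides obey the recurrence; use the cases m and m-h.
  beyond : ∀ m → h < m → (∀ {k} → k < suc m → LucasIdentity h k) → LucasIdentity h (suc m)
  beyond m h<m ih _ = begin
    L h (suc n)                       ≡⟨ hseq-rec h (lucInit h) n (<⇒≤ (s≤s h<m)) ⟩
    L h n + L h (n ∸ h)               ≡⟨ cong (λ x → L h n + L h x) n∸h ⟩
    L h n + L h (suc p)               ≡⟨ cong₂ _+_ (ih ≤-refl (≤-trans (s≤s z≤n) h<m))
                                                   (ih (s≤s (m∸n≤m m h)) (m<n⇒0<n∸m h<m)) ⟩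
    (F h n + h * F h p) + (F h (suc p) + h * F h (p ∸ h))
                                      ≡⟨ interchange (F h n) (h * F h p) (F h (suc p)) _ ⟩
    (F h n + F h (suc p)) + (h * F h p + h * F h (p ∸ h))
                                      ≡⟨ cong₂ _+_ (cong (λ x → F h n + F h x) (sym n∸h))
                                                   (sym (*-distribˡ-+ h (F h p) _)) ⟩
    (F h n + F h (n ∸ h)) + h * (F h p + F h (p ∸ h))
                                      ≡⟨ cong₂ (λ x y → x + h * y)
                                          (sym (F-rec h n (s≤s z≤n)))
                                          (sym (F-rec h p (m<n⇒0<n∸m h<m))) ⟩
    F h (suc n) + h * F h (suc p)     ≡⟨ cong (λ x → F h (suc n) + h * F h x) (sym n∸h) ⟩
    F h (suc n) + h * F h (n ∸ h) ∎
    where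
    n = suc m
    p = m ∸ h
    n∸h : n ∸ h ≡ suc p
    n∸h = +-∸-assoc 1 (<⇒≤ h<m)

  step : ∀ n → (∀ {k} → k < n → LucasIdentity h k) → LucasIdentity h n
  step n ih with <-cmp n (suc h)
  step zero _ | _ = λ ()
  step (suc t) _ | tri< (s≤s t<h) _ _ = window t t<h
  step (suc t) _ | tri≈ _ refl _ = first
  step (suc m) ih | tri> _ _ (s≤s h<m) = beyond m h<m ih

lemma5p1 : (h n : ℕ) → h < n → L h (suc n) ≡ F h n + suc h * F h (n ∸ h)
lemma5p1 h n h<n = begin
  L h (suc n)                         ≡⟨ lucas-as-fib h n 0<n ⟩
  F h (suc n) + h * F h (n ∸ h)       ≡⟨ cong (_+ h * F h (n ∸ h)) (F-rec h n 0<n) ⟩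
  F h n + F h (n ∸ h) + h * F h (n ∸ h) ≡⟨ +-assoc (F h n) _ _ ⟩
  F h n + suc h * F h (n ∸ h) ∎
  where
  0<n : 0 < n
  0<n = ≤-trans (s≤s z≤n) h<n
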